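{- Let $X$ be a set of variables, $s$ a term, and let $s^{\bullet_X}=s[x_1,\dots,x_n]_{p_1,\dots,p_n}$ where $\{p_1,\dots,p_n\}=\mathrm{Pos}_{X\cup\mathrm{Val}}(s)$ and $x_1,\dots,x_n$ are pairwise distinct fresh variables. Let $\ell$ be a linear term and $\gamma$ a substitution with $\mathrm{Dom}(\gamma)=\mathrm{Var}(\ell)$ and $s|_p=\ell\gamma$ for a position $p$ of $s$. Define $\gamma^{\bullet_X}$ by $\gamma^{\bullet_X}(x)=s^{\bullet_X}|_{p\cdot q}$ for each $x\in\mathrm{Var}(\ell)$, where $q$ is the unique position with $\ell|_q=x$ (so that $\gamma(x)=s|_{p\cdot q}$), and $\gamma^{\bullet_X}(x)=x$ otherwise. If $\ell$ contains no values, then $s^{\bullet_X}|_p=\ell\gamma^{\bullet_X}$.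
   Context: Terms are built over a sorted signature and variables; $\mathrm{Val}$ is a distinguished set of constant symbols (values). $\mathrm{Var}(\ell)$ is the set of variables of $\ell$; $\ell$ is linear if no variable occurs more than once in it. $\mathrm{Pos}_{X\cup\mathrm{Val}}(s)$ is the set of positions of $s$ at which a variable of $X$ or a value occurs; $s|_p$ is the subterm at position $p$, $p\cdot q$ is concatenation of positions, and $s[t_1,\dots,t_n]_{p_1,\dots,p_n}$ replaces the subterms at the positions $p_i$ by $t_i$. Fresh means not occurring in $s$. $\mathrm{Dom}(\gamma)=\{x\mid\gamma(x)\neq x\}$. -}

module Defs where

open import Data.Nat using (ℕ; zero; suc)
open import Data.List using (List; []; _∷_; _++_; foldl; zip; map)
open import Data.Vec using (Vec; []; _∷_)
open import Data.Maybe using (Maybe; just; nothing)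
open import Data.Product using (_×_; _,_; ∃; ∃-syntax)
open import Data.Sum using (_⊎_)
open import Data.Unit using (⊤)
open import Relation.Nullary using (¬_)
open import Relation.Binary.PropositionalEquality using (_≡_; _≢_)
open import Data.List.Membership.Propositional using (_∈_; _∉_)
open import Data.List.Relation.Unary.Unique.Propositional using (Unique)

record Signature : Set₁ where
  field
    Fun       : Set
    arity     : Fun → ℕ
    Val       : Fun → Set
    val-const : ∀ {f} → Val f → arity f ≡ 0

module Terms (Sig : Signature) (V : Set) where
  open Signature Sig

  data Term : Set where
    var : V → Term
    fun : (f : Fun) → Vec Term (arity f) → Term

  -- positions: lists of 0-based argument indices; ε = []
  Pos : Set
  Pos = List ℕ

  mutual
    _∣_ : Term → Pos → Maybe Term
    t ∣ [] = just t
    var x ∣ (i ∷ p) = nothing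
    fun f ts ∣ (i ∷ p) = subV ts i p

    subV : ∀ {n} → Vec Term n → ℕ → Pos → Maybe Term
    subV [] i p = nothing
    subV (t ∷ ts) zero p = t ∣ p
    subV (t ∷ ts) (suc i) p = subV ts i p

  -- s[t]_p (unchanged if p is not a position of s)
  mutual
    replace : Term → Pos → Term → Term
    replace s [] t = t
    replace (var x) (i ∷ p) t = var x
    replace (fun f ts) (i ∷ p) t = fun f (replaceV ts i p t)

    replaceV : ∀ {n} → Vec Term n → ℕ → Pos → Term → Vec Term n
    replaceV [] i p t = []
    replaceV (u ∷ us) zero p t = replace u p t ∷ us
    replaceV (u ∷ us) (suc i) p t = u ∷ replaceV us i p t

  -- s[t_1,…,t_n]_{p_1,…,p_n}, performed one after another
  -- (for pairwise parallel positions this equals simultaneous replacement)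
  replaceAll : Term → List (Pos × Term) → Term
  replaceAll s pts = foldl (λ u pt → replace u (Data.Product.proj₁ pt) (Data.Product.proj₂ pt)) s pts

  -- Var(t), as a list (with repetitions)
  mutual
    vars : Term → List V
    vars (var x) = x ∷ []
    vars (fun f ts) = varsV ts

    varsV : ∀ {n} → Vec Term n → List V
    varsV [] = []
    varsV (t ∷ ts) = vars t ++ varsV ts

  Linear : Term → Set
  Linear t = Unique (vars t)

  mutual
    NoValues : Term → Set
    NoValues (var x) = ⊤
    NoValues (fun f ts) = ¬ Val f × NoValuesV ts

    NoValuesV : ∀ {n} → Vec Term n → Set
    NoValuesV [] = ⊤
    NoValuesV (t ∷ ts) = NoValues t × NoValuesV ts

  Subst : Set
  Subst = V → Term

  mutual
    _⟨_⟩ : Term → Subst → Term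
    var x ⟨ γ ⟩ = γ x
    fun f ts ⟨ γ ⟩ = fun f (substV ts γ)

    substV : ∀ {n} → Vec Term n → Subst → Vec Term n
    substV [] γ = []
    substV (t ∷ ts) γ = (t ⟨ γ ⟩) ∷ substV ts γ

  DomEqVars : Subst → Term → Set
  DomEqVars γ t = ∀ x → (γ x ≢ var x → x ∈ vars t) × (x ∈ vars t → γ x ≢ var x)

  PosXVal : (V → Set) → Term → Pos → Set
  PosXVal X s p =
      (∃[ x ] (X x × s ∣ p ≡ just (var x)))
    ⊎ (∃[ f ] ∃[ ts ] (Val f × s ∣ p ≡ just (fun f ts)))

  IsBullet : (V → Set) → Term → Term → Set
  IsBullet X s sb =
    ∃[ ps ] ∃[ xs ]
      ( Unique ps
      × (∀ p → (p ∈ ps → PosXVal X s p) × (PosXVal X s p → p ∈ ps))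
      × Data.List.length ps ≡ Data.List.length xs
      × Unique xs
      × (∀ x → x ∈ xs → x ∉ vars s)
      × sb ≡ replaceAll s (zip ps (map var xs)) )

  IsBulletSubst : Term → Term → Pos → Subst → Set
  IsBulletSubst sb ℓ p δ =
      (∀ x q → ℓ ∣ q ≡ just (var x) → sb ∣ (p ++ q) ≡ just (δ x))
    × (∀ x → x ∉ vars ℓ → δ x ≡ var x)

{-# OPTIONS --safe #-}
module Submission where

open import Defs
open import Data.Empty using (⊥-elim)
open import Data.List using (List; []; _∷_; _++_; zip; map)
open import Data.List.Membership.Propositional using (_∈_)
open import Data.List.Relation.Binary.Prefix.Heterogeneous using (Prefix; []; _∷_)
open import Data.List.Relation.Binary.Prefix.Propositional.Properties using (Prefix-as-∣ˡ)
open import Data.List.Relation.Unary.Any using (here; there)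
open import Data.Maybe as Maybe using (Maybe; just; nothing; _>>=_)
open import Data.Maybe.Properties using (just-injective)
open import Data.Nat using (zero; suc)
open import Data.Product using (_,_; proj₁; proj₂)
open import Data.Sum using (_⊎_; inj₁; inj₂)
open import Data.Vec using (Vec; []; _∷_)
open import Function using (_∘_)
open import Relation.Nullary using (¬_)
open import Relation.Binary.PropositionalEquality using (_≡_; refl; sym; trans; cong; cong₂)

-- s^{•X} arises from s by replacing subterms at positions of
-- variables of X and of values only.  Such a position has no proper
-- extension inside s, so it cannot be a prefix of a position p·q at which
-- s = …(ℓγ)… carries a function symbol of ℓ, since ℓ has no values.  Hence
-- s^{•X} still has the same function symbol at every p·q with ℓ|_q a
-- function symbol, and by definition γ^{•X}(x) at every p·q with ℓ|_q = x.
-- A term is determined by these data, so s^{•X}|_p = ℓγ^{•X}.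

module TermProperties (Sig : Signature) (V : Set) where
  open Signature Sig
  open Terms Sig V

  root : Term → V ⊎ Fun
  root (var x)    = inj₁ x
  root (fun f ts) = inj₂ f

  symbolAt : Term → Pos → Maybe (V ⊎ Fun)
  symbolAt t r = Maybe.map root (t ∣ r)

  mutual
    ∣-++ : ∀ s p q → s ∣ (p ++ q) ≡ (s ∣ p >>= _∣ q)
    ∣-++ s          []      q = refl
    ∣-++ (var x)    (i ∷ p) q = refl
    ∣-++ (fun f ts) (i ∷ p) q = subV-++ ts i p q

    subV-++ : ∀ {n} (ts : Vec Term n) i p q → subV ts i (p ++ q) ≡ (subV ts i p >>= _∣ q)
    subV-++ []       i       p q = refl
    subV-++ (t ∷ ts) zero    p q = ∣-++ t p q
    subV-++ (t ∷ ts) (suc i) p q = subV-++ ts i p q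

  ∣-++-just : ∀ s p q {t} → s ∣ p ≡ just t → s ∣ (p ++ q) ≡ t ∣ q
  ∣-++-just s p q sp = trans (∣-++ s p q) (cong (_>>= _∣ q) sp)

  ∣-var : ∀ {x} r {t} → var x ∣ r ≡ just t → t ≡ var x
  ∣-var [] refl = refl

  subV-nullary : ∀ {n} (ts : Vec Term n) {i r} → n ≡ 0 → subV ts i r ≡ nothing
  subV-nullary [] _ = refl

  ∣-nullary : ∀ {g} {ts : Vec Term (arity g)} r {t} → arity g ≡ 0 → fun g ts ∣ r ≡ just t → t ≡ fun g ts
  ∣-nullary []      _   refl = refl
  ∣-nullary {ts = ts} (i ∷ r) g-nullary tr with trans (sym (subV-nullary ts g-nullary)) tr
  ... | ()

  mutual
    ∣-⟨⟩ : ∀ (γ : Subst) ℓ q {u} → ℓ ∣ q ≡ just u → (ℓ ⟨ γ ⟩) ∣ q ≡ just (u ⟨ γ ⟩)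
    ∣-⟨⟩ γ ℓ          []      refl = refl
    ∣-⟨⟩ γ (fun f ts) (i ∷ q) ℓq   = subV-substV γ ts i q ℓq

    subV-substV : ∀ {n} (γ : Subst) (ts : Vec Term n) i q {u} →
                  subV ts i q ≡ just u → subV (substV ts γ) i q ≡ just (u ⟨ γ ⟩)
    subV-substV γ (t ∷ ts) zero    q tq = ∣-⟨⟩ γ t q tq
    subV-substV γ (t ∷ ts) (suc i) q tq = subV-substV γ ts i q tq

  mutual
    NoValues-∣ : ∀ ℓ q {u} → NoValues ℓ → ℓ ∣ q ≡ just u → NoValues u
    NoValues-∣ ℓ          []      nv refl = nv
    NoValues-∣ (fun f ts) (i ∷ q) nv ℓq   = NoValuesV-subV ts i q (proj₂ nv) ℓq

    NoValuesV-subV : ∀ {n} (ts : Vec Term n) i q {u} → NoValuesV ts → subV ts i q ≡ just u → NoValues u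
    NoValuesV-subV (t ∷ ts) zero    q (nv , _)  tq = NoValues-∣ t q nv tq
    NoValuesV-subV (t ∷ ts) (suc i) q (_ , nvs) tq = NoValuesV-subV ts i q nvs tq

  mutual
    symbolAt-replace : ∀ t p u r → ¬ Prefix _≡_ p r → symbolAt (replace t p u) r ≡ symbolAt t r
    symbolAt-replace t          []      u r       p⋢r = ⊥-elim (p⋢r [])
    symbolAt-replace (var x)    (i ∷ p) u r       p⋢r = refl
    symbolAt-replace (fun g ts) (i ∷ p) u []      p⋢r = refl
    symbolAt-replace (fun g ts) (i ∷ p) u (j ∷ r) p⋢r =
      root-subV-replaceV ts i p u j r λ { refl → p⋢r ∘ (refl ∷_) }

    root-subV-replaceV : ∀ {n} (ts : Vec Term n) i p u j r → (i ≡ j → ¬ Prefix _≡_ p r) →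
                         Maybe.map root (subV (replaceV ts i p u) j r) ≡ Maybe.map root (subV ts j r)
    root-subV-replaceV []       i       p u j       r p⋢r = refl
    root-subV-replaceV (t ∷ ts) zero    p u zero    r p⋢r = symbolAt-replace t p u r (p⋢r refl)
    root-subV-replaceV (t ∷ ts) zero    p u (suc j) r p⋢r = refl
    root-subV-replaceV (t ∷ ts) (suc i) p u zero    r p⋢r = refl
    root-subV-replaceV (t ∷ ts) (suc i) p u (suc j) r p⋢r = root-subV-replaceV ts i p u j r (p⋢r ∘ cong suc)

  symbolAt-replaceAll : ∀ t (ps : List Pos) (us : List Term) r →
                        (∀ {p} → p ∈ ps → ¬ Prefix _≡_ p r) →
                        symbolAt (replaceAll t (zip ps us)) r ≡ symbolAt t r
  symbolAt-replaceAll t []       us       r ps⋢r = refl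
  symbolAt-replaceAll t (p ∷ ps) []       r ps⋢r = refl
  symbolAt-replaceAll t (p ∷ ps) (u ∷ us) r ps⋢r =
    trans (symbolAt-replaceAll (replace t p u) ps us r (ps⋢r ∘ there))
          (symbolAt-replace t p u r (ps⋢r (here refl)))

  PosXVal-++⇒Val : ∀ {X} s p r {f ws} → PosXVal X s p → s ∣ (p ++ r) ≡ just (fun f ws) → Val f
  PosXVal-++⇒Val s p r (inj₁ (x , _ , sp)) spr with ∣-var r (trans (sym (∣-++-just s p r sp)) spr)
  ... | ()
  PosXVal-++⇒Val s p r (inj₂ (g , ts , val-g , sp)) spr
    with ∣-nullary r (val-const val-g) (trans (sym (∣-++-just s p r sp)) spr)
  ... | refl = val-g

  mutual
    ≡-⟨⟩-positionwise : ∀ (δ : Subst) u t →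
      (∀ x q → u ∣ q ≡ just (var x) → t ∣ q ≡ just (δ x)) →
      (∀ f ws q → u ∣ q ≡ just (fun f ws) → symbolAt t q ≡ just (inj₂ f)) →
      t ≡ u ⟨ δ ⟩
    ≡-⟨⟩-positionwise δ (var x) t atVar atFun = just-injective (atVar x [] refl)
    ≡-⟨⟩-positionwise δ (fun f us) (var y) atVar atFun with atFun f us [] refl
    ... | ()
    ≡-⟨⟩-positionwise δ (fun f us) (fun g ts) atVar atFun with atFun f us [] refl
    ... | refl = cong (fun f) (≡-substV-positionwise δ us ts
                   (λ x i q → atVar x (i ∷ q)) (λ h ws i q → atFun h ws (i ∷ q)))

    ≡-substV-positionwise : ∀ {n} (δ : Subst) (us ts : Vec Term n) →
      (∀ x i q → subV us i q ≡ just (var x) → subV ts i q ≡ just (δ x)) →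
      (∀ f ws i q → subV us i q ≡ just (fun f ws) → Maybe.map root (subV ts i q) ≡ just (inj₂ f)) →
      ts ≡ substV us δ
    ≡-substV-positionwise δ []       []       atVar atFun = refl
    ≡-substV-positionwise δ (u ∷ us) (t ∷ ts) atVar atFun =
      cong₂ _∷_ (≡-⟨⟩-positionwise δ u t (λ x → atVar x zero) (λ f ws → atFun f ws zero))
                (≡-substV-positionwise δ us ts (λ x → atVar x ∘ suc) (λ f ws → atFun f ws ∘ suc))

  ∣≡just-⟨⟩-positionwise : ∀ (δ : Subst) u t p →
    (∀ x q → u ∣ q ≡ just (var x) → t ∣ (p ++ q) ≡ just (δ x)) →
    (∀ f ws q → u ∣ q ≡ just (fun f ws) → symbolAt t (p ++ q) ≡ just (inj₂ f)) →
    t ∣ p ≡ just (u ⟨ δ ⟩)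
  ∣≡just-⟨⟩-positionwise δ u t p atVar atFun with t ∣ p | ∣-++ t p
  ... | just v | t∣p++ = cong just (≡-⟨⟩-positionwise δ u v
          (λ x q uq → trans (sym (t∣p++ q)) (atVar x q uq))
          (λ f ws q uq → trans (cong (Maybe.map root) (sym (t∣p++ q))) (atFun f ws q uq)))
  ∣≡just-⟨⟩-positionwise δ (var x) t p atVar atFun | nothing | t∣p++
    with trans (sym (t∣p++ [])) (atVar x [] refl)
  ... | ()
  ∣≡just-⟨⟩-positionwise δ (fun f us) t p atVar atFun | nothing | t∣p++
    with trans (cong (Maybe.map root) (sym (t∣p++ []))) (atFun f us [] refl)
  ... | ()

-- Linearity of ℓ and Dom(γ) = Var(ℓ) are what make γ^{•X} well defined;
-- here δ comes with its defining property.
mainTheorem15 :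
    (Sig : Signature) (V : Set) →
    let open Terms Sig V in
    (X : V → Set) (s sb ℓ : Term) (γ δ : Subst) (p : Pos) →
    IsBullet X s sb →
    Linear ℓ →
    DomEqVars γ ℓ →
    s ∣ p ≡ just (ℓ ⟨ γ ⟩) →
    IsBulletSubst sb ℓ p δ →
    NoValues ℓ →
    sb ∣ p ≡ just (ℓ ⟨ δ ⟩)
mainTheorem15 Sig V X s sb ℓ γ δ p (ps , xs , _ , posXVal , _ , _ , _ , refl) _ _ sp (atVar , _) nv =
  ∣≡just-⟨⟩-positionwise δ ℓ sb p atVar atFun
  where
    open Terms Sig V
    open TermProperties Sig V

    atFun : ∀ f ws q → ℓ ∣ q ≡ just (fun f ws) → symbolAt sb (p ++ q) ≡ just (inj₂ f)
    atFun f ws q ℓq =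
      trans (symbolAt-replaceAll s ps (map var xs) (p ++ q) ps⋢p++q) (cong (Maybe.map root) spq)
      where
        spq : s ∣ (p ++ q) ≡ just (fun f (substV ws γ))
        spq = trans (∣-++-just s p q sp) (∣-⟨⟩ γ ℓ q ℓq)

        ps⋢p++q : ∀ {p′} → p′ ∈ ps → ¬ Prefix _≡_ p′ (p ++ q)
        ps⋢p++q {p′} p′∈ps p′⊑p++q with Prefix-as-∣ˡ p′⊑p++q
        ... | record { quotient = r ; equality = p′++r≡p++q } =
          proj₁ (NoValues-∣ ℓ q nv ℓq)
                (PosXVal-++⇒Val s p′ r (proj₁ (posXVal p′) p′∈ps) (trans (cong (s ∣_) p′++r≡p++q) spq))
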